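{- For every positive integer $n$ with $n \equiv 0 \pmod 4$ or $n \equiv 1 \pmod 4$, the transitive tournament $TT_n$ admits a chain--collider--fork decomposition.
   Context: The transitive tournament $TT_n$ has vertex set $\{v_1,\dots,v_n\}$ and arc set $\{(v_i,v_j): 1\le i<j\le n\}$ (an arc $(u,v)$ is written $u\to v$). A chain is a digraph on three distinct vertices with arcs $a\to b\to c$; a collider is one with arcs $a\to b\leftarrow c$; a fork is one with arcs $a\leftarrow b\to c$. A chain--collider--fork decomposition of $TT_n$ is a partition of the arc set of $TT_n$ into two-element sets of arcs, each of which forms (as a subdigraph) a chain, a collider, or a fork. -}

module Defs where

open import Data.Nat using (ℕ)
open import Data.Fin using (Fin; _<_)
open import Data.Product using (_×_; _,_; ∃-syntax; proj₁; proj₂)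
open import Data.Sum using (_⊎_)
open import Data.List using (List; []; _∷_; concatMap)
open import Data.List.Membership.Propositional using (_∈_)
open import Data.List.Relation.Unary.All using (All)
open import Data.List.Relation.Unary.Unique.Propositional using (Unique)
open import Relation.Binary.PropositionalEquality using (_≡_; _≢_)

-- Vertices of TT_n are Fin n (v_{i+1} ↔ i); an arc u → v is the ordered pair (u , v).
Arc : ℕ → Set
Arc n = Fin n × Fin n

IsArcTT : ∀ {n} → Arc n → Set
IsArcTT (u , v) = u < v

Distinct3 : ∀ {n} → Fin n → Fin n → Fin n → Set
Distinct3 a b c = (a ≢ b) × (b ≢ c) × (a ≢ c)

Chain : ∀ {n} → Arc n → Arc n → Set
Chain {n} e f = ∃[ a ] ∃[ b ] ∃[ c ] (Distinct3 {n} a b c × e ≡ (a , b) × f ≡ (b , c))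

Collider : ∀ {n} → Arc n → Arc n → Set
Collider {n} e f = ∃[ a ] ∃[ b ] ∃[ c ] (Distinct3 {n} a b c × e ≡ (a , b) × f ≡ (c , b))

Fork : ∀ {n} → Arc n → Arc n → Set
Fork {n} e f = ∃[ a ] ∃[ b ] ∃[ c ] (Distinct3 {n} a b c × e ≡ (b , a) × f ≡ (b , c))

-- the two-element arc set {e , f} forms a chain, a collider or a fork
-- (the set is unordered, so both orders are allowed)
IsCCF : ∀ {n} → Arc n × Arc n → Set
IsCCF (e , f) = (Chain e f ⊎ Chain f e) ⊎ (Collider e f ⊎ Collider f e) ⊎ (Fork e f ⊎ Fork f e)

arcsOf : ∀ {n} → List (Arc n × Arc n) → List (Arc n)
arcsOf = concatMap (λ p → proj₁ p ∷ proj₂ p ∷ [])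

record CCFDecomposition (n : ℕ) : Set where
  field
    blocks    : List (Arc n × Arc n)
    shape     : All IsCCF blocks
    inTT      : All IsArcTT (arcsOf blocks)
    covers    : ∀ (e : Arc n) → IsArcTT e → e ∈ arcsOf blocks
    disjoint  : Unique (arcsOf blocks)

{-# OPTIONS --safe #-}
-- The arcs of TT_(m+n) are those of TT_m, those of TT_n (shifted past the first m vertices) and
-- the m·n arcs from the first m vertices to the last n, so decompositions of these three parts
-- combine.  For m = 4, TT₄ splits into a chain, a fork and a collider, and the four arcs into each
-- later vertex w form the colliders v₀ → w ← v₁ and v₂ → w ← v₃.  Induction from the arc-free TT₀
-- and TT₁ then covers every n ≡ 0, 1 (mod 4).
module Submission where

open import Defs
open import Data.Nat as ℕ using (ℕ; zero; suc; _+_; _%_; _>_)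
import Data.Nat.Properties as ℕ
open import Data.Fin using (Fin; zero; suc; toℕ; _<_; _↑ˡ_; _↑ʳ_; #_)
open import Data.Fin.Properties
  using (suc-injective; ↑ˡ-injective; ↑ʳ-injective; toℕ-↑ˡ; toℕ-↑ʳ; toℕ<n; <-asym; _<?_; all?)
  renaming (_≟_ to _≟ᶠ_)
open import Data.Product using (_×_; _,_; proj₁; proj₂; ∃-syntax)
open import Data.Product.Properties using (≡-dec)
open import Data.Sum using (_⊎_; inj₁; inj₂; [_,_]′)
import Data.Sum as Sum
open import Data.Empty using (⊥-elim)
open import Data.List using (List; []; _∷_; _++_; map; allFin; cartesianProductWith)
open import Data.List.Properties using (concatMap-++)
open import Data.List.Membership.Propositional using (_∈_)
open import Data.List.Membership.Propositional.Properties
  using (∈-map⁺; ∈-map⁻; ∈-++⁺ˡ; ∈-++⁺ʳ; ∈-++⁻; ∈-allFin; ∈-cartesianProductWith⁺; ∈-cartesianProductWith⁻)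
open import Data.List.Relation.Unary.All using (All; []; _∷_)
import Data.List.Relation.Unary.All as All
import Data.List.Relation.Unary.All.Properties as All
open import Data.List.Relation.Unary.AllPairs using ([])
open import Data.List.Relation.Unary.Unique.Propositional using (Unique)
import Data.List.Relation.Unary.Unique.Propositional.Properties as Unique
open import Function using (_∘_)
open import Function.Definitions using (Injective)
open import Level using (0ℓ)
open import Relation.Binary.PropositionalEquality using (_≡_; _≢_; refl; sym; cong; cong₂; subst; subst₂)
open import Relation.Nullary using (¬_)
open import Relation.Nullary.Decidable using (toWitness; _→-dec_)
open import Relation.Unary using (Pred; Empty; _⊆_; _∪_; _≐_; _⊥_)
open import Relation.Unary.Properties using (≐-sym)

private
  variable
    k m n : ℕ

data Split (m n : ℕ) : Fin (m + n) → Set where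
  left  : (i : Fin m) → Split m n (i ↑ˡ n)
  right : (j : Fin n) → Split m n (m ↑ʳ j)

split : ∀ m {n} (u : Fin (m + n)) → Split m n u
split zero    u       = right u
split (suc m) zero    = left zero
split (suc m) (suc u) with split m u
... | left i  = left (suc i)
... | right j = right j

↑ˡ≢↑ʳ : (i : Fin m) (j : Fin n) → i ↑ˡ n ≢ m ↑ʳ j
↑ˡ≢↑ʳ (suc i) j eq = ↑ˡ≢↑ʳ i j (suc-injective eq)

↑ˡ-mono-< : ∀ n {i j : Fin m} → i < j → i ↑ˡ n < j ↑ˡ n
↑ˡ-mono-< n {i} {j} = subst₂ ℕ._<_ (sym (toℕ-↑ˡ i n)) (sym (toℕ-↑ˡ j n))

↑ˡ-cancel-< : ∀ n {i j : Fin m} → i ↑ˡ n < j ↑ˡ n → i < j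
↑ˡ-cancel-< n {i} {j} = subst₂ ℕ._<_ (toℕ-↑ˡ i n) (toℕ-↑ˡ j n)

↑ʳ-mono-< : ∀ m {i j : Fin n} → i < j → m ↑ʳ i < m ↑ʳ j
↑ʳ-mono-< m {i} {j} i<j = subst₂ ℕ._<_ (sym (toℕ-↑ʳ m i)) (sym (toℕ-↑ʳ m j)) (ℕ.+-monoʳ-< m i<j)

↑ʳ-cancel-< : ∀ m {i j : Fin n} → m ↑ʳ i < m ↑ʳ j → i < j
↑ʳ-cancel-< m {i} {j} lt = ℕ.+-cancelˡ-< m (toℕ i) (toℕ j) (subst₂ ℕ._<_ (toℕ-↑ʳ m i) (toℕ-↑ʳ m j) lt)

↑ˡ<↑ʳ : (i : Fin m) (j : Fin n) → i ↑ˡ n < m ↑ʳ j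
↑ˡ<↑ʳ {m} {n} i j = subst₂ ℕ._<_ (sym (toℕ-↑ˡ i n)) (sym (toℕ-↑ʳ m j))
  (ℕ.<-≤-trans (toℕ<n i) (ℕ.m≤m+n m (toℕ j)))

mapArc : (Fin m → Fin k) → Arc m → Arc k
mapArc g (u , v) = (g u , g v)

mapBlock : (Fin m → Fin k) → Arc m × Arc m → Arc k × Arc k
mapBlock g (e , f) = (mapArc g e , mapArc g f)

Image : {A B : Set} → (A → B) → Pred A 0ℓ → Pred B 0ℓ
Image g P y = ∃[ x ] P x × g x ≡ y

module _ {g : Fin m → Fin k} (g-injective : Injective _≡_ _≡_ g) where

  mapArc-injective : Injective _≡_ _≡_ (mapArc g)
  mapArc-injective eq = cong₂ _,_ (g-injective (cong proj₁ eq)) (g-injective (cong proj₂ eq))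

  Distinct3-map : {a b c : Fin m} → Distinct3 a b c → Distinct3 (g a) (g b) (g c)
  Distinct3-map (a≢b , b≢c , a≢c) = a≢b ∘ g-injective , b≢c ∘ g-injective , a≢c ∘ g-injective

  Chain-map : {e f : Arc m} → Chain e f → Chain (mapArc g e) (mapArc g f)
  Chain-map (a , b , c , d , refl , refl) = g a , g b , g c , Distinct3-map d , refl , refl

  Collider-map : {e f : Arc m} → Collider e f → Collider (mapArc g e) (mapArc g f)
  Collider-map (a , b , c , d , refl , refl) = g a , g b , g c , Distinct3-map d , refl , refl

  Fork-map : {e f : Arc m} → Fork e f → Fork (mapArc g e) (mapArc g f)
  Fork-map (a , b , c , d , refl , refl) = g a , g b , g c , Distinct3-map d , refl , refl

  IsCCF-map : {b : Arc m × Arc m} → IsCCF b → IsCCF (mapBlock g b)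
  IsCCF-map = Sum.map (Sum.map Chain-map Chain-map)
                      (Sum.map (Sum.map Collider-map Collider-map) (Sum.map Fork-map Fork-map))

arcsOf-++ : (bs cs : List (Arc n × Arc n)) → arcsOf (bs ++ cs) ≡ arcsOf bs ++ arcsOf cs
arcsOf-++ = concatMap-++ _

arcsOf-map : (g : Fin m → Fin k) (bs : List (Arc m × Arc m)) →
             arcsOf (map (mapBlock g) bs) ≡ map (mapArc g) (arcsOf bs)
arcsOf-map g []             = refl
arcsOf-map g ((e , f) ∷ bs) = cong (λ l → mapArc g e ∷ mapArc g f ∷ l) (arcsOf-map g bs)

record Decomposition (P : Pred (Arc n) 0ℓ) : Set where
  field
    blocks : List (Arc n × Arc n)
    shape  : All IsCCF blocks
    unique : Unique (arcsOf blocks)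
    arcs≐P : (_∈ arcsOf blocks) ≐ P

toCCFDecomposition : Decomposition (IsArcTT {n}) → CCFDecomposition n
toCCFDecomposition D = record
  { blocks   = blocks
  ; shape    = shape
  ; inTT     = All.tabulate (proj₁ arcs≐P)
  ; covers   = λ _ → proj₂ arcs≐P
  ; disjoint = unique
  }
  where open Decomposition D

empty : {P : Pred (Arc n) 0ℓ} → Empty P → Decomposition P
empty P-empty = record
  { blocks = [] ; shape = [] ; unique = [] ; arcs≐P = (λ ()) , λ {e} p → ⊥-elim (P-empty e p) }

resp-≐ : {P Q : Pred (Arc n) 0ℓ} → P ≐ Q → Decomposition P → Decomposition Q
resp-≐ (P⊆Q , Q⊆P) D = record
  { blocks = blocks ; shape = shape ; unique = unique
  ; arcs≐P = P⊆Q ∘ proj₁ arcs≐P , proj₂ arcs≐P ∘ Q⊆P }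
  where open Decomposition D

union : {P Q : Pred (Arc n) 0ℓ} → P ⊥ Q → Decomposition P → Decomposition Q → Decomposition (P ∪ Q)
union {P = P} {Q} P⊥Q D E = record
  { blocks = D.blocks ++ E.blocks
  ; shape  = All.++⁺ D.shape E.shape
  ; unique = subst Unique (sym arcs) (Unique.++⁺ D.unique E.unique disjoint)
  ; arcs≐P = sound , complete
  }
  where
  module D = Decomposition D
  module E = Decomposition E
  arcs : arcsOf (D.blocks ++ E.blocks) ≡ arcsOf D.blocks ++ arcsOf E.blocks
  arcs = arcsOf-++ D.blocks E.blocks
  disjoint : ∀ {e} → ¬ (e ∈ arcsOf D.blocks × e ∈ arcsOf E.blocks)
  disjoint (e∈D , e∈E) = P⊥Q (proj₁ D.arcs≐P e∈D , proj₁ E.arcs≐P e∈E)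
  sound : (_∈ arcsOf (D.blocks ++ E.blocks)) ⊆ P ∪ Q
  sound e∈ = Sum.map (proj₁ D.arcs≐P) (proj₁ E.arcs≐P) (∈-++⁻ (arcsOf D.blocks) (subst (_ ∈_) arcs e∈))
  complete : P ∪ Q ⊆ (_∈ arcsOf (D.blocks ++ E.blocks))
  complete = subst (_ ∈_) (sym arcs) ∘ [ ∈-++⁺ˡ ∘ proj₂ D.arcs≐P , ∈-++⁺ʳ _ ∘ proj₂ E.arcs≐P ]′

image : {g : Fin m → Fin k} → Injective _≡_ _≡_ g →
        {P : Pred (Arc m) 0ℓ} → Decomposition P → Decomposition (Image (mapArc g) P)
image {g = g} g-injective {P} D = record
  { blocks = map (mapBlock g) blocks
  ; shape  = All.map⁺ (All.map (IsCCF-map g-injective) shape)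
  ; unique = subst Unique (sym arcs) (Unique.map⁺ (mapArc-injective g-injective) unique)
  ; arcs≐P = sound , complete
  }
  where
  open Decomposition D
  arcs : arcsOf (map (mapBlock g) blocks) ≡ map (mapArc g) (arcsOf blocks)
  arcs = arcsOf-map g blocks
  sound : (_∈ arcsOf (map (mapBlock g) blocks)) ⊆ Image (mapArc g) P
  sound e∈ with ∈-map⁻ (mapArc g) (subst (_ ∈_) arcs e∈)
  ... | e′ , e′∈ , refl = e′ , proj₁ arcs≐P e′∈ , refl
  complete : Image (mapArc g) P ⊆ (_∈ arcsOf (map (mapBlock g) blocks))
  complete (e′ , p , refl) = subst (_ ∈_) (sym arcs) (∈-map⁺ (mapArc g) (proj₂ arcs≐P p))

Crossing : ∀ m n → Pred (Arc (m + n)) 0ℓ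
Crossing m n e = ∃[ i ] ∃[ j ] (i ↑ˡ n , m ↑ʳ j) ≡ e

Left : ∀ m n → Pred (Arc (m + n)) 0ℓ
Left m n = Image (mapArc (_↑ˡ n)) IsArcTT

Right : ∀ m n → Pred (Arc (m + n)) 0ℓ
Right m n = Image (mapArc (m ↑ʳ_)) IsArcTT

IsArcTT-split : ∀ m n → IsArcTT ≐ Left m n ∪ (Crossing m n ∪ Right m n)
IsArcTT-split m n = into , from
  where
  into : IsArcTT ⊆ Left m n ∪ (Crossing m n ∪ Right m n)
  into {u , v} u<v with split m u | split m v
  ... | left i  | left i′  = inj₁ ((i , i′) , ↑ˡ-cancel-< n u<v , refl)
  ... | left i  | right j  = inj₂ (inj₁ (i , j , refl))
  ... | right j | left i   = ⊥-elim (<-asym u<v (↑ˡ<↑ʳ i j))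
  ... | right j | right j′ = inj₂ (inj₂ ((j , j′) , ↑ʳ-cancel-< m u<v , refl))
  from : Left m n ∪ (Crossing m n ∪ Right m n) ⊆ IsArcTT
  from (inj₁ (_ , i<i′ , refl))        = ↑ˡ-mono-< n i<i′
  from (inj₂ (inj₁ (i , j , refl)))    = ↑ˡ<↑ʳ i j
  from (inj₂ (inj₂ (_ , j<j′ , refl))) = ↑ʳ-mono-< m j<j′

Left⊥Crossing∪Right : ∀ m n → Left m n ⊥ (Crossing m n ∪ Right m n)
Left⊥Crossing∪Right m n ((_ , _ , refl) , inj₁ (_ , j , eq)) =
  ↑ˡ≢↑ʳ _ j (sym (cong proj₂ eq))
Left⊥Crossing∪Right m n (((i , _) , _ , refl) , inj₂ ((j , _) , _ , eq)) =
  ↑ˡ≢↑ʳ i j (sym (cong proj₁ eq))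

Crossing⊥Right : ∀ m n → Crossing m n ⊥ Right m n
Crossing⊥Right m n ((i , _ , refl) , ((j , _) , _ , eq)) = ↑ˡ≢↑ʳ i j (sym (cong proj₁ eq))

join : Decomposition (IsArcTT {m}) → Decomposition (Crossing m n) → Decomposition (IsArcTT {n}) →
       Decomposition (IsArcTT {m + n})
join {m} {n} TTm K TTn =
  resp-≐ (≐-sym (IsArcTT-split m n))
    (union (Left⊥Crossing∪Right m n) (image (↑ˡ-injective n _ _) TTm)
      (union (Crossing⊥Right m n) K (image (↑ʳ-injective m _ _) TTn)))

crossingArc : Fin n → Fin 4 → Arc (4 + n)
crossingArc {n} j a = (a ↑ˡ n , 4 ↑ʳ j)

crossingBlocks : List (Fin n) → List (Arc (4 + n) × Arc (4 + n))
crossingBlocks []       = []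
crossingBlocks (j ∷ js) = (crossingArc j (# 0) , crossingArc j (# 1))
                        ∷ (crossingArc j (# 2) , crossingArc j (# 3))
                        ∷ crossingBlocks js

arcsOf-crossingBlocks : (js : List (Fin n)) →
                        arcsOf (crossingBlocks js) ≡ cartesianProductWith crossingArc js (allFin 4)
arcsOf-crossingBlocks []       = refl
arcsOf-crossingBlocks (j ∷ js) = cong (map (crossingArc j) (allFin 4) ++_) (arcsOf-crossingBlocks js)

crossingBlocks-colliders : (js : List (Fin n)) → All IsCCF (crossingBlocks js)
crossingBlocks-colliders         []       = []
crossingBlocks-colliders {n} (j ∷ js) = collider (λ ()) ∷ collider (λ ()) ∷ crossingBlocks-colliders js
  where
  collider : {a b : Fin 4} → a ≢ b → IsCCF (crossingArc j a , crossingArc j b)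
  collider {a} {b} a≢b = inj₂ (inj₁ (inj₁ (a ↑ˡ n , 4 ↑ʳ j , b ↑ˡ n ,
    (↑ˡ≢↑ʳ a j , ↑ˡ≢↑ʳ b j ∘ sym , a≢b ∘ ↑ˡ-injective n a b) , refl , refl)))

crossing : ∀ n → Decomposition (Crossing 4 n)
crossing n = record
  { blocks = crossingBlocks (allFin n)
  ; shape  = crossingBlocks-colliders (allFin n)
  ; unique = subst Unique (sym arcs)
      (Unique.cartesianProductWith⁺ crossingArc crossingArc-injective (Unique.allFin⁺ n) (Unique.allFin⁺ 4))
  ; arcs≐P = sound , complete
  }
  where
  arcs : arcsOf (crossingBlocks (allFin n)) ≡ cartesianProductWith crossingArc (allFin n) (allFin 4)
  arcs = arcsOf-crossingBlocks (allFin n)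
  crossingArc-injective : ∀ {j j′ a a′} → crossingArc j a ≡ crossingArc j′ a′ → j ≡ j′ × a ≡ a′
  crossingArc-injective eq = ↑ʳ-injective 4 _ _ (cong proj₂ eq) , ↑ˡ-injective n _ _ (cong proj₁ eq)
  sound : (_∈ arcsOf (crossingBlocks (allFin n))) ⊆ Crossing 4 n
  sound e∈ with ∈-cartesianProductWith⁻ crossingArc (allFin n) (allFin 4) (subst (_ ∈_) arcs e∈)
  ... | j , a , _ , _ , refl = a , j , refl
  complete : Crossing 4 n ⊆ (_∈ arcsOf (crossingBlocks (allFin n)))
  complete (a , j , refl) =
    subst (crossingArc j a ∈_) (sym arcs) (∈-cartesianProductWith⁺ crossingArc (∈-allFin j) (∈-allFin a))

TT₄ : Decomposition (IsArcTT {4})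
TT₄ = record
  { blocks = blocks
  ; shape  = inj₁ (inj₁ (# 0 , # 1 , # 2 , ((λ ()) , (λ ()) , (λ ())) , refl , refl))
           ∷ inj₂ (inj₂ (inj₁ (# 2 , # 0 , # 3 , ((λ ()) , (λ ()) , (λ ())) , refl , refl)))
           ∷ inj₂ (inj₁ (inj₁ (# 1 , # 3 , # 2 , ((λ ()) , (λ ()) , (λ ())) , refl , refl)))
           ∷ []
  ; unique = toWitness {a? = unique? (arcsOf blocks)} _
  ; arcs≐P = All.lookup (toWitness {a? = All.all? (λ e → proj₁ e <? proj₂ e) (arcsOf blocks)} _)
           , λ {(u , v)} → toWitness {a? = all? λ u → all? λ v → u <? v →-dec (u , v) ∈? arcsOf blocks} _ u v
  }
  where
  open import Data.List.Membership.DecPropositional (≡-dec _≟ᶠ_ _≟ᶠ_) using (_∈?_)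
  open import Data.List.Relation.Unary.Unique.DecPropositional (≡-dec _≟ᶠ_ _≟ᶠ_) using (unique?)
  blocks : List (Arc 4 × Arc 4)
  blocks = ((# 0 , # 1) , (# 1 , # 2)) ∷ ((# 0 , # 2) , (# 0 , # 3)) ∷ ((# 1 , # 3) , (# 2 , # 3)) ∷ []

ttDecomposition : ∀ n → n % 4 ≡ 0 ⊎ n % 4 ≡ 1 → Decomposition (IsArcTT {n})
ttDecomposition 0 _         = empty λ { (() , _) }
ttDecomposition 1 _         = empty λ { (zero , zero) () }
ttDecomposition 2 (inj₁ ())
ttDecomposition 2 (inj₂ ())
ttDecomposition 3 (inj₁ ())
ttDecomposition 3 (inj₂ ())
-- (4 + n) % 4 reduces to n % 4 by computation, so the hypothesis passes to n unchanged.
ttDecomposition (suc (suc (suc (suc n)))) n≡0,1 = join TT₄ (crossing n) (ttDecomposition n n≡0,1)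

-- TT₀ has no arcs.
mainTheorem1 : (n : ℕ) → n > 0 → (n % 4 ≡ 0 ⊎ n % 4 ≡ 1) → CCFDecomposition n
mainTheorem1 n _ n≡0,1 = toCCFDecomposition (ttDecomposition n n≡0,1)
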